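{- For every odd integer $\ell\ge 5$, the cycle $C_\ell$ is $2$-weakly Cockayne–Lorimer.
   Context: $\nu(G)$ is the matching number. For $\mathbf{t}=(t_1,\dots,t_q)\in\mathbb{N}_+^q$ (positive integers), $\Lambda_\mathbf{t}=\sum_{i=1}^q(t_i-1)$, and $G\to\mathbf{t}K_2$ means every colouring of the edges of $G$ with colours $1,\dots,q$ contains, for some $j$, a matching of size $t_j$ all of whose edges have colour $j$. $G$ is $q$-weakly Cockayne–Lorimer if there exists $\mathbf{t}\in\mathbb{N}_+^q$ with $\Lambda_\mathbf{t}\ge\nu(G)$ such that $G\to\mathbf{t}K_2$. -}

module Defs where

open import Data.Nat using (ℕ; suc; _∸_; _≤_; NonZero)
open import Data.Nat.DivMod using (_%_; m%n<n)
open import Data.Fin using (Fin; toℕ; fromℕ<)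
open import Data.Product using (_×_; _,_; proj₁; proj₂; Σ; ∃; ∃-syntax)
open import Data.List using (List; length; map; allFin)
open import Data.Nat.ListAction using (sum)
open import Data.List.Relation.Unary.All using (All)
open import Data.List.Relation.Unary.AllPairs using (AllPairs)
open import Relation.Binary.PropositionalEquality using (_≡_; _≢_)

record Graph : Set where
  field
    nV : ℕ
    nE : ℕ
    ends : Fin nE → Fin nV × Fin nV

open Graph public

Disjoint : (G : Graph) → Fin (nE G) → Fin (nE G) → Set
Disjoint G e f =
  (proj₁ (ends G e) ≢ proj₁ (ends G f)) × (proj₁ (ends G e) ≢ proj₂ (ends G f)) ×
  (proj₂ (ends G e) ≢ proj₁ (ends G f)) × (proj₂ (ends G e) ≢ proj₂ (ends G f))

-- A matching: a list of edges, pairwise vertex-disjoint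
-- (this forces the listed edges to be distinct, so its size is its length).
IsMatching : (G : Graph) → List (Fin (nE G)) → Set
IsMatching G M = AllPairs (Disjoint G) M

IsMatchingNumber : Graph → ℕ → Set
IsMatchingNumber G k =
  (Σ (List (Fin (nE G))) λ M → IsMatching G M × length M ≡ k) ×
  (∀ (M : List (Fin (nE G))) → IsMatching G M → length M ≤ k)

Λ : ∀ {q} → (Fin q → ℕ) → ℕ
Λ {q} t = sum (map (λ i → t i ∸ 1) (allFin q))

Positive : ∀ {q} → (Fin q → ℕ) → Set
Positive {q} t = ∀ (i : Fin q) → 1 ≤ t i

Arrows : (G : Graph) → ∀ {q} → (Fin q → ℕ) → Set
Arrows G {q} t =
  ∀ (c : Fin (nE G) → Fin q) →
    ∃[ j ] Σ (List (Fin (nE G))) λ M →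
      IsMatching G M × length M ≡ t j × All (λ e → c e ≡ j) M

WeaklyCL : ℕ → Graph → Set
WeaklyCL q G =
  ∀ (ν : ℕ) → IsMatchingNumber G ν →
    Σ (Fin q → ℕ) λ t → Positive t × ν ≤ Λ t × Arrows G t

cycleGraph : (ℓ : ℕ) → .{{_ : NonZero ℓ}} → Graph
cycleGraph ℓ = record
  { nV = ℓ
  ; nE = ℓ
  ; ends = λ i → i , fromℕ< (m%n<n (suc (toℕ i)) ℓ)
  }

{-# OPTIONS --safe #-}
-- Write ℓ = 2k + 1 and give red (colour 0) the target 2 and blue (colour 1) the target k, so that
-- Λ = k ≥ ν(C_ℓ), a matching M having 2|M| distinct endpoints. If no edge is red, every other
-- edge is a blue k-matching. Otherwise let edge a be red. A red edge among a+2, …, a+2k−1, the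
-- edges not touching a, makes a red 2-matching with a. If these are all blue, then a blue a+1
-- gives the blue matching a+1, a+3, …, a+2k−1, a blue a−1 = a+2k gives a+2, a+4, …, a+2k, and
-- if both are red they form a red 2-matching, being disjoint because ℓ ≥ 5.
module Submission where

open import Data.Fin using (Fin; zero; suc; toℕ; _≟_)
open import Data.Fin.Properties using (toℕ-injective; toℕ-fromℕ<; toℕ<n; injective⇒≤; any?)
open import Data.List using (List; []; _∷_; length; lookup; applyUpTo)
open import Data.List.Membership.Propositional.Properties using (∈-lookup)
open import Data.List.Properties using (length-applyUpTo)
open import Data.List.Relation.Unary.All as All using (All; []; _∷_)
open import Data.List.Relation.Unary.All.Properties using (applyUpTo⁺₁)
open import Data.List.Relation.Unary.AllPairs using ([]; _∷_)
import Data.List.Relation.Unary.AllPairs.Properties as AllPairs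
open import Data.List.Relation.Unary.Unique.Propositional using (Unique)
open import Data.Nat using (ℕ; zero; suc; _+_; _*_; _≤_; _<_; s≤s; s≤s⁻¹; z≤n; NonZero; _<?_; _≤?_)
open import Data.Nat.DivMod using (_%_; _/_; _mod_; m≡m%n+[m/n]*n; m%n%n≡m%n; %-distribˡ-+; m<n⇒m%n≡m)
open import Data.Nat.Properties hiding (_≟_)
open import Data.Product using (_×_; _,_; proj₁; proj₂; Σ; ∃-syntax)
open import Data.Sum using (inj₁; inj₂)
open import Relation.Binary.PropositionalEquality
open import Relation.Nullary using (yes; no; contradiction; _×-dec_)
open import Defs

lookup-injective : ∀ {A : Set} {xs : List A} → Unique xs →
                   ∀ i j → lookup xs i ≡ lookup xs j → i ≡ j
lookup-injective (_ ∷ _) zero zero _ = refl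
lookup-injective (x∉xs ∷ _) zero (suc j) eq = contradiction eq (All.lookup x∉xs (∈-lookup j))
lookup-injective (x∉xs ∷ _) (suc i) zero eq = contradiction (sym eq) (All.lookup x∉xs (∈-lookup i))
lookup-injective (_ ∷ u) (suc i) (suc j) eq = cong suc (lookup-injective u i j eq)

Unique⇒length≤ : ∀ {n} {xs : List (Fin n)} → Unique xs → length xs ≤ n
Unique⇒length≤ u = injective⇒≤ (lookup-injective u _ _)

Loopless : Graph → Set
Loopless G = ∀ e → proj₁ (ends G e) ≢ proj₂ (ends G e)

module _ (G : Graph) where

  endpoints : List (Fin (nE G)) → List (Fin (nV G))
  endpoints [] = []
  endpoints (e ∷ M) = proj₁ (ends G e) ∷ proj₂ (ends G e) ∷ endpoints M

  length-endpoints : ∀ M → length (endpoints M) ≡ 2 * length M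
  length-endpoints [] = refl
  length-endpoints (e ∷ M) = trans (cong (2 +_) (length-endpoints M)) (sym (*-suc 2 (length M)))

  endpoints-avoid : ∀ {e M} → All (Disjoint G e) M →
    All (proj₁ (ends G e) ≢_) (endpoints M) × All (proj₂ (ends G e) ≢_) (endpoints M)
  endpoints-avoid [] = [] , []
  endpoints-avoid ((d₁₁ , d₁₂ , d₂₁ , d₂₂) ∷ ds) with endpoints-avoid ds
  ... | s , t = (d₁₁ ∷ d₁₂ ∷ s) , (d₂₁ ∷ d₂₂ ∷ t)

  endpoints-unique : Loopless G → ∀ {M} → IsMatching G M → Unique (endpoints M)
  endpoints-unique loopless {[]} [] = []
  endpoints-unique loopless {e ∷ M} (d ∷ m) with endpoints-avoid d
  ... | s , t = (loopless e ∷ s) ∷ t ∷ endpoints-unique loopless m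

  matching-size : Loopless G → ∀ {M} → IsMatching G M → 2 * length M ≤ nV G
  matching-size loopless {M} m =
    subst (_≤ nV G) (length-endpoints M) (Unique⇒length≤ (endpoints-unique loopless m))

MonochromaticMatching : (G : Graph) {q : ℕ} → (Fin q → ℕ) → (Fin (nE G) → Fin q) → Set
MonochromaticMatching G t c =
  ∃[ j ] Σ (List (Fin (nE G))) λ M → IsMatching G M × length M ≡ t j × All (λ e → c e ≡ j) M

m<o<m+n⇒m%n≢o%n : ∀ {m o} n .{{_ : NonZero n}} → m < o → o < m + n → m % n ≢ o % n
m<o<m+n⇒m%n≢o%n {m} {o} n m<o o<m+n m%n≡o%n with m / n <? o / n
... | yes q<q′ = <⇒≱ o<m+n (begin
  m + n                   ≡⟨ cong (_+ n) (m≡m%n+[m/n]*n m n) ⟩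
  m % n + m / n * n + n   ≡⟨ +-assoc (m % n) _ n ⟩
  m % n + (m / n * n + n) ≡⟨ cong₂ _+_ m%n≡o%n (+-comm _ n) ⟩
  o % n + suc (m / n) * n ≤⟨ +-monoʳ-≤ (o % n) (*-monoˡ-≤ n q<q′) ⟩
  o % n + o / n * n       ≡⟨ m≡m%n+[m/n]*n o n ⟨
  o                       ∎)
  where open ≤-Reasoning
... | no q≮q′ = <⇒≱ m<o (begin
  o                 ≡⟨ m≡m%n+[m/n]*n o n ⟩
  o % n + o / n * n ≤⟨ +-mono-≤ (≤-reflexive (sym m%n≡o%n)) (*-monoˡ-≤ n (≮⇒≥ q≮q′)) ⟩
  m % n + m / n * n ≡⟨ m≡m%n+[m/n]*n m n ⟨
  m                 ∎)
  where open ≤-Reasoning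

[1+m%n]%n≡[1+m]%n : ∀ m n .{{_ : NonZero n}} → suc (m % n) % n ≡ suc m % n
[1+m%n]%n≡[1+m]%n m n = begin
  (1 + m % n) % n           ≡⟨ %-distribˡ-+ 1 (m % n) n ⟩
  (1 % n + m % n % n) % n   ≡⟨ cong (λ r → (1 % n + r) % n) (m%n%n≡m%n m n) ⟩
  (1 % n + m % n) % n       ≡⟨ %-distribˡ-+ 1 m n ⟨
  (1 + m) % n               ∎
  where open ≡-Reasoning

2+[m+n]≡m+[2+n] : ∀ m n → 2 + (m + n) ≡ m + (2 + n)
2+[m+n]≡m+[2+n] m n = sym (trans (+-suc m (suc n)) (cong suc (+-suc m n)))

2+[m+2n]≡m+2[1+n] : ∀ m n → 2 + (m + 2 * n) ≡ m + 2 * suc n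
2+[m+2n]≡m+2[1+n] m n = trans (2+[m+n]≡m+[2+n] m (2 * n)) (cong (m +_) (sym (*-suc 2 n)))

module Cycle (ℓ : ℕ) .{{_ : NonZero ℓ}} where

  C : Graph
  C = cycleGraph ℓ

  edge : ℕ → Fin ℓ
  edge x = x mod ℓ

  edge-toℕ : ∀ e → edge (toℕ e) ≡ e
  edge-toℕ e = toℕ-injective (trans (toℕ-fromℕ< _) (m<n⇒m%n≡m (toℕ<n e)))

  toℕ-tail : ∀ x → toℕ (proj₁ (ends C (edge x))) ≡ x % ℓ
  toℕ-tail x = toℕ-fromℕ< _

  toℕ-head : ∀ x → toℕ (proj₂ (ends C (edge x))) ≡ suc x % ℓ
  toℕ-head x = trans (toℕ-fromℕ< _) (trans (cong (λ r → suc r % ℓ) (toℕ-fromℕ< _)) ([1+m%n]%n≡[1+m]%n x ℓ))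

  vertices-distinct : ∀ {u v : Fin ℓ} {m o} → toℕ u ≡ m % ℓ → toℕ v ≡ o % ℓ →
             m < o → o < m + ℓ → u ≢ v
  vertices-distinct u≡m v≡o m<o o<m+ℓ refl = m<o<m+n⇒m%n≢o%n ℓ m<o o<m+ℓ (trans (sym u≡m) v≡o)

  edge-disjoint : ∀ {x y} → 2 + x ≤ y → 2 + y ≤ x + ℓ → Disjoint C (edge x) (edge y)
  edge-disjoint {x} {y} 2+x≤y 2+y≤x+ℓ =
    vertices-distinct (toℕ-tail x) (toℕ-tail y) (<⇒≤ 2+x≤y) (<⇒≤ 2+y≤x+ℓ) ,
    vertices-distinct (toℕ-tail x) (toℕ-head y) (m≤n⇒m≤1+n (<⇒≤ 2+x≤y)) 2+y≤x+ℓ ,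
    vertices-distinct (toℕ-head x) (toℕ-tail y) 2+x≤y (m≤n⇒m≤1+n (<⇒≤ 2+y≤x+ℓ)) ,
    vertices-distinct (toℕ-head x) (toℕ-head y) (s≤s (<⇒≤ 2+x≤y)) (s≤s (<⇒≤ 2+y≤x+ℓ))

  loopless : 2 ≤ ℓ → Loopless C
  loopless 2≤ℓ e = subst (λ e → proj₁ (ends C e) ≢ proj₂ (ends C e)) (edge-toℕ e)
    (vertices-distinct (toℕ-tail x) (toℕ-head x) ≤-refl (subst (2 + x ≤_) (+-comm ℓ x) (+-monoˡ-≤ x 2≤ℓ)))
    where x = toℕ e

  alternate : ℕ → ℕ → List (Fin ℓ)
  alternate b n = applyUpTo (λ i → edge (b + 2 * i)) n

  alternate-matching : ∀ b n → 2 * n ≤ ℓ → IsMatching C (alternate b n)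
  alternate-matching b n 2n≤ℓ = AllPairs.applyUpTo⁺₁ _ n apart
    where
    apart : ∀ {i j} → i < j → j < n → Disjoint C (edge (b + 2 * i)) (edge (b + 2 * j))
    apart {i} {j} i<j j<n = edge-disjoint
      (begin
        2 + (b + 2 * i) ≡⟨ 2+[m+2n]≡m+2[1+n] b i ⟩
        b + 2 * suc i   ≤⟨ +-monoʳ-≤ b (*-monoʳ-≤ 2 i<j) ⟩
        b + 2 * j       ∎)
      (begin
        2 + (b + 2 * j) ≡⟨ 2+[m+2n]≡m+2[1+n] b j ⟩
        b + 2 * suc j   ≤⟨ +-monoʳ-≤ b (≤-trans (*-monoʳ-≤ 2 j<n) 2n≤ℓ) ⟩
        b + ℓ           ≤⟨ +-monoˡ-≤ ℓ (m≤m+n b (2 * i)) ⟩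
        b + 2 * i + ℓ   ∎)
      where open ≤-Reasoning

  edge-disjoint-offset : ∀ x {d} → 2 ≤ d → 2 + d ≤ ℓ → Disjoint C (edge x) (edge (x + d))
  edge-disjoint-offset x {d} 2≤d 2+d≤ℓ = edge-disjoint
    (subst (_≤ x + d) (+-comm x 2) (+-monoʳ-≤ x 2≤d))
    (subst (_≤ x + ℓ) (sym (2+[m+n]≡m+[2+n] x d)) (+-monoʳ-≤ x 2+d≤ℓ))

pattern red  = zero
pattern blue = suc zero

≢red⇒blue : ∀ {j : Fin 2} → j ≢ red → j ≡ blue
≢red⇒blue {red}  j≢red = contradiction refl j≢red
≢red⇒blue {blue} _     = refl

budget : ℕ → Fin 2 → ℕ
budget k red  = 2
budget k blue = k

budget-positive : ∀ {k} → 1 ≤ k → Positive (budget k)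
budget-positive _   red  = s≤s z≤n
budget-positive 1≤k blue = 1≤k

Λ-budget : ∀ {k} → 1 ≤ k → Λ (budget k) ≡ k
Λ-budget {suc j} _ = cong suc (+-identityʳ j)

module OddCycle (k : ℕ) (2≤k : 2 ≤ k) where

  ℓ : ℕ
  ℓ = suc (2 * k)

  open Cycle ℓ

  2≤ℓ : 2 ≤ ℓ
  2≤ℓ = m≤n⇒m≤1+n (≤-trans 2≤k (m≤m+n k _))

  matching-size≤k : ∀ {M} → IsMatching C M → length M ≤ k
  matching-size≤k {M} m = m<1+n⇒m≤n (*-cancelˡ-< 2 (length M) (suc k) (begin-strict
    2 * length M ≤⟨ matching-size C (loopless 2≤ℓ) m ⟩
    ℓ            <⟨ ≤-refl ⟩
    2 + 2 * k    ≡⟨ *-suc 2 k ⟨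
    2 * suc k    ∎))
    where open ≤-Reasoning

  module _ (c : Fin ℓ → Fin 2) where

    red-pair : ∀ x y → Disjoint C (edge x) (edge y) → c (edge x) ≡ red → c (edge y) ≡ red →
               MonochromaticMatching C (budget k) c
    red-pair _ _ x∩y=∅ x-red y-red =
      red , _ ∷ _ ∷ [] , ((x∩y=∅ ∷ []) ∷ [] ∷ []) , refl , x-red ∷ y-red ∷ []

    blue-run : ∀ b → (∀ {i} → i < k → c (edge (b + 2 * i)) ≡ blue) →
               MonochromaticMatching C (budget k) c
    blue-run b run-blue = blue , alternate b k , alternate-matching b k (n≤1+n _) ,
      length-applyUpTo _ k , applyUpTo⁺₁ _ k run-blue

    WindowBlue : ℕ → Set
    WindowBlue a = ∀ {d} → 2 ≤ d → d < 2 * k → c (edge (a + d)) ≡ blue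

    flanks : ∀ a → WindowBlue a → MonochromaticMatching C (budget k) c
    flanks a window with c (edge (a + 1)) ≟ red | c (edge (a + 2 * k)) ≟ red
    ... | no ¬red₁ | _ = blue-run (a + 1) (λ {i} i<k →
      subst (λ x → c (edge x) ≡ blue) (sym (+-assoc a 1 (2 * i))) (odd-offset i<k))
      where
      odd-offset : ∀ {i} → i < k → c (edge (a + (1 + 2 * i))) ≡ blue
      odd-offset {zero}  _   = ≢red⇒blue ¬red₁
      odd-offset {suc i} i<k = window (s≤s (s≤s z≤n)) (subst (_≤ 2 * k) (*-suc 2 (suc i)) (*-monoʳ-≤ 2 i<k))
    ... | yes _ | no ¬red₂ = blue-run (a + 2) (λ {i} i<k →
      subst (λ x → c (edge x) ≡ blue) (sym (+-assoc a 2 (2 * i))) (even-offset i<k))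
      where
      even-offset : ∀ {i} → i < k → c (edge (a + (2 + 2 * i))) ≡ blue
      even-offset {i} i<k with m≤n⇒m<n∨m≡n i<k
      ... | inj₁ 1+i<k = window (s≤s (s≤s z≤n)) (begin
        3 + 2 * i         ≤⟨ n≤1+n _ ⟩
        2 + (2 + 2 * i)   ≡⟨ cong (2 +_) (*-suc 2 i) ⟨
        2 + 2 * suc i     ≡⟨ *-suc 2 (suc i) ⟨
        2 * suc (suc i)   ≤⟨ *-monoʳ-≤ 2 1+i<k ⟩
        2 * k             ∎)
        where open ≤-Reasoning
      ... | inj₂ 1+i≡k = subst (λ d → c (edge (a + d)) ≡ blue)
        (trans (cong (2 *_) (sym 1+i≡k)) (*-suc 2 i)) (≢red⇒blue ¬red₂)
    ... | yes red₁ | yes red₂ = red-pair (a + 1) (a + 2 * k) (edge-disjoint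
      (subst (_≤ a + 2 * k) (sym (2+[m+n]≡m+[2+n] a 1)) (+-monoʳ-≤ a 3≤2k))
      (≤-reflexive (trans (2+[m+n]≡m+[2+n] a (2 * k)) (sym (+-assoc a 1 ℓ))))) red₁ red₂
      where
      3≤2k : 3 ≤ 2 * k
      3≤2k = ≤-trans (n≤1+n 3) (*-monoʳ-≤ 2 2≤k)

    around-red-edge : ∀ a → c (edge a) ≡ red → MonochromaticMatching C (budget k) c
    around-red-edge a a-red with anyUpTo? (λ d → (2 ≤? d) ×-dec (c (edge (a + d)) ≟ red)) (2 * k)
    ... | yes (d , d<2k , 2≤d , d-red) = red-pair a (a + d) (edge-disjoint-offset a 2≤d (s≤s d<2k)) a-red d-red
    ... | no no-red = flanks a (λ 2≤d d<2k → ≢red⇒blue (λ d-red → no-red (_ , d<2k , 2≤d , d-red)))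

  arrows : Arrows C (budget k)
  arrows c with any? (λ e → c e ≟ red)
  ... | yes (e , e-red) = around-red-edge c (toℕ e) (subst (λ e → c e ≡ red) (sym (edge-toℕ e)) e-red)
  ... | no no-red = blue-run c 0 (λ _ → ≢red⇒blue (λ e-red → no-red (_ , e-red)))

  weakly-cockayne-lorimer : WeaklyCL 2 C
  weakly-cockayne-lorimer _ ((M , m , refl) , _) =
    budget k , budget-positive 1≤k ,
    ≤-trans (matching-size≤k m) (≤-reflexive (sym (Λ-budget 1≤k))) , arrows
    where
    1≤k : 1 ≤ k
    1≤k = ≤-trans (n≤1+n 1) 2≤k

odd⇒1+2* : ∀ n → n % 2 ≡ 1 → ∃[ k ] n ≡ suc (2 * k)
odd⇒1+2* n n-odd = n / 2 , trans (m≡m%n+[m/n]*n n 2) (cong₂ _+_ n-odd (*-comm (n / 2) 2))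

proposition4p3 : (ℓ : ℕ) .{{_ : NonZero ℓ}} → 5 ≤ ℓ → ℓ % 2 ≡ 1 →
    WeaklyCL 2 (cycleGraph ℓ)
proposition4p3 ℓ 5≤ℓ ℓ-odd with k , refl ← odd⇒1+2* ℓ ℓ-odd =
  OddCycle.weakly-cockayne-lorimer k (*-cancelˡ-≤ {m = 2} 2 (s≤s⁻¹ 5≤ℓ))
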